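{- Let $T$ be a rooted tree with root $r$, and let $\{I(u): u\in V(T)\}$ be a family of pairwise distinct intervals (one for each node). Suppose every node $u$ satisfies the local partial order conditions: (LPO1) if $u\neq r$, then $I(u)\subseteq I(\operatorname{sp}(u))\cap I(\operatorname{sp}(\operatorname{parent}(u)))$; (LPO2) $I(x)\prec I(u)$ for every $x\in\operatorname{lqa}(u)$. Then for every two distinct nodes $u,v$ of $T$, $u$ is an ancestor of $v$ if and only if both of the following hold: (D1) $I(v)\subset I(\operatorname{sp}(u))$, and (D2) $I(u)\prec I(v)$ or $I(u)=I(\operatorname{sp}(u))$.
   Context: For integers $a\le b$, the interval $[a,b]$ is the set of integers $\{a,\dots,b\}$; for intervals $I=[a,b]$, $I'=[a',b']$ we write $I\prec I'$ if $b<a'$. In a rooted tree, $u$ is an ancestor of $v$ if $u\ne v$ and $u$ lies on the path from $v$ to the root; $v$ is then a descendant of $u$; $\operatorname{parent}(u)$ is the ancestor at distance $1$. The weight of a node is the number of nodes in its subtree (including itself). For each non-leaf node $u$, among the children of maximum weight exactly one is chosen (arbitrarily) and called heavy; all other nodes, including the root, are light. The supervisor $\operatorname{sp}(u)$ is the light node of largest depth on the path from $u$ to the root. The nodes are numbered $0,\dots,|T|-1$ by $\mathrm{DFS}(u)$, according to a depth-first traversal starting at the root that visits the light children of each node before its heavy child. For nodes $v,w$, $P[v,w]$ is the path between them (inclusive). For a non-root node $u$, let $P_u=P[\operatorname{parent}(u),\operatorname{sp}(\operatorname{parent}(u))]$; the set $\operatorname{lqa}(u)$ of local quasi-ancestors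 of $u$ consists of all nodes of $P_u$ together with their light children, excluding $u$, excluding $\operatorname{sp}(\operatorname{parent}(u))$, and excluding all nodes $x$ with $\mathrm{DFS}(x)>\mathrm{DFS}(u)$. For the root, $\operatorname{lqa}(r)=\emptyset$. -}

module Defs where

open import Data.Nat using (ℕ; zero; suc; _+_)
open import Data.Fin using (Fin; toℕ)
open import Data.List using (List; []; _∷_; length; lookup; take)
open import Data.List.Relation.Unary.All using (All)
open import Data.Integer using (ℤ) renaming (_≤_ to _≤ℤ_; _<_ to _<ℤ_)
open import Data.Product using (_×_; Σ)
open import Data.Sum using (_⊎_)
open import Data.Bool using (Bool; true; false)
open import Data.Unit using (⊤)
open import Relation.Nullary using (¬_)
open import Relation.Binary.PropositionalEquality using (_≡_; _≢_)

-- A node is either a leaf, or has a list of light children (listed in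
-- the order in which the DFS visits them) and one heavy child (visited
-- last).

data Tree : Set where
  leaf : Tree
  node : List Tree → Tree → Tree

mutual
  -- weight = number of nodes of the tree
  size : Tree → ℕ
  size leaf = 1
  size (node ls h) = suc (sizes ls + size h)

  sizes : List Tree → ℕ
  sizes [] = 0
  sizes (t ∷ ts) = size t + sizes ts

-- Positions (= nodes) of a tree.
data Pos : Tree → Set where
  root  : {t : Tree} → Pos t
  light : {ls : List Tree} {h : Tree} (i : Fin (length ls)) →
          Pos (lookup ls i) → Pos (node ls h)
  heavy : {ls : List Tree} {h : Tree} → Pos h → Pos (node ls h)

subtree : (t : Tree) → Pos t → Tree
subtree t root = t
subtree (node ls h) (light i p) = subtree (lookup ls i) p
subtree (node ls h) (heavy p) = subtree h p

HeavyOK : Tree → Set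
HeavyOK leaf = ⊤
HeavyOK (node ls h) = All (λ l → size l Data.Nat.≤ size h) ls

WF : Tree → Set
WF t = (p : Pos t) → HeavyOK (subtree t p)

data _⊏_ : {t : Tree} → Pos t → Pos t → Set where
  root⊏light : ∀ {ls h i p} → root ⊏ light {ls} {h} i p
  root⊏heavy : ∀ {ls h p} → root ⊏ heavy {ls} {h} p
  light⊏light : ∀ {ls h i p q} → p ⊏ q → light {ls} {h} i p ⊏ light i q
  heavy⊏heavy : ∀ {ls h p q} → p ⊏ q → heavy {ls} {h} p ⊏ heavy q

_⊑_ : {t : Tree} → Pos t → Pos t → Set
u ⊑ v = u ≡ v ⊎ u ⊏ v

-- light nodes: the root and all non-heavy children
-- case distinction: is a position the root?
ifRoot : {s : Tree} {A : Set} → Pos s → A → A → A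
ifRoot root a b = a
ifRoot (light i p) a b = b
ifRoot (heavy p) a b = b

isLight : {t : Tree} → Pos t → Bool
isLight root = true
isLight (light i p) = isLight p
isLight (heavy p) = ifRoot p false (isLight p)

-- parent (the parent of the root is set to the root; only used for non-roots)
parent : {t : Tree} → Pos t → Pos t
parent root = root
parent (light i p) = ifRoot p root (light i (parent p))
parent (heavy p) = ifRoot p root (heavy (parent p))

-- supervisor: light node of largest depth on the path from u to the root
liftH : {ls : List Tree} {h : Tree} → Pos h → Pos (node ls h)
liftH p = ifRoot p root (heavy p)

sp : {t : Tree} → Pos t → Pos t
sp root = root
sp (light i p) = light i (sp p)
sp (heavy p) = liftH (sp p)

-- DFS number: light children in list order first, heavy child last
DFS : {t : Tree} → Pos t → ℕ
DFS root = 0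
DFS {node ls h} (light i p) = suc (sizes (take (toℕ i) ls) + DFS p)
DFS {node ls h} (heavy p) = suc (sizes ls + DFS p)

-- local quasi-ancestors
-- y lies on P_u = P[parent(u), sp(parent(u))]
OnPu : {t : Tree} → Pos t → Pos t → Set
OnPu u y = sp (parent u) ⊑ y × y ⊑ parent u

InLqa : {t : Tree} → (u x : Pos t) → Set
InLqa u x =
  u ≢ root ×
  (OnPu u x ⊎ (x ≢ root × isLight x ≡ true × OnPu u (parent x))) ×
  x ≢ u ×
  x ≢ sp (parent u) ×
  DFS x Data.Nat.≤ DFS u

record Interval : Set where
  constructor [_,_]⟨_⟩
  field
    lo : ℤ
    hi : ℤ
    lo≤hi : lo ≤ℤ hi
open Interval public

_∈ᵢ_ : ℤ → Interval → Set
z ∈ᵢ I = lo I ≤ℤ z × z ≤ℤ hi I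

_⊆ᵢ_ : Interval → Interval → Set
I ⊆ᵢ J = ∀ z → z ∈ᵢ I → z ∈ᵢ J

_≐_ : Interval → Interval → Set
I ≐ J = I ⊆ᵢ J × J ⊆ᵢ I

_⊂ᵢ_ : Interval → Interval → Set
I ⊂ᵢ J = I ⊆ᵢ J × ¬ (I ≐ J)

_⊆ᵢ_∩_ : Interval → Interval → Interval → Set
I ⊆ᵢ J ∩ K = ∀ z → z ∈ᵢ I → (z ∈ᵢ J × z ∈ᵢ K)

_≺_ : Interval → Interval → Set
I ≺ J = hi I <ℤ lo J

module Submission where

-- The two local conditions are turned into two global facts:
--   (nesting)  if s is light and s ⊑ w, then I(w) ⊆ I(s); this follows
--              from LPO1 alone, since along a descending path I ∘ sp can
--              only shrink;
--   (ordering) if u is heavy and u ⊏ v, or if x comes before y in the DFS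
--              order without being its ancestor, then I(x) ≺ I(y).  In
--              both cases LPO2 is applied at the first light node w where
--              the path towards the later node leaves a heavy path, and
--              the nesting fact transports I(x) ≺ I(w) to the later node.
-- The forward direction of the theorem is then immediate.  For the
-- converse, any two distinct nodes are related in one of four ways
-- (ancestor, descendant, before, after); in each of the three wrong
-- configurations (D1) and (D2) contradict nesting or ordering, using
-- purely combinatorial facts about heavy paths.

open import Defs
open import Data.Bool using (Bool; true; false)
open import Data.Empty using (⊥; ⊥-elim)
open import Data.Fin using (Fin; toℕ; zero; suc)
import Data.Fin.Properties as FinP
import Data.Integer as ℤ
import Data.Integer.Properties as ℤP
open import Data.List using (List; []; _∷_; length; lookup; take)
open import Data.Nat as ℕ using (ℕ; suc; _+_; z≤n; s≤s)
import Data.Nat.Properties as ℕP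
open import Data.Product using (_×_; _,_; proj₁; proj₂; Σ; ∃)
open import Data.Sum using (_⊎_; inj₁; inj₂)
open import Function.Bundles using (_⇔_; mk⇔)
open import Relation.Binary.Construct.Closure.ReflexiveTransitive
  using (Star; ε; _◅_; gmap; fold) renaming (map to Star-map)
open import Relation.Binary.Definitions using (tri<; tri≈; tri>)
open import Relation.Binary.PropositionalEquality
  using (_≡_; _≢_; refl; sym; trans; cong; subst; subst₂)
open import Relation.Nullary using (¬_)

-- DFS numbers.  The nodes of a subtree receive a contiguous block of
-- numbers, and the block of light child i precedes all later children.

size-pos : (t : Tree) → 1 ℕ.≤ size t
size-pos leaf = s≤s z≤n
size-pos (node ls h) = s≤s z≤n

sizes-take-suc : (ls : List Tree) (i : Fin (length ls)) →
  sizes (take (toℕ i) ls) + size (lookup ls i) ≡ sizes (take (suc (toℕ i)) ls)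
sizes-take-suc (l ∷ ls) zero = sym (ℕP.+-identityʳ (size l))
sizes-take-suc (l ∷ ls) (suc i) =
  trans (ℕP.+-assoc (size l) (sizes (take (toℕ i) ls)) (size (lookup ls i)))
        (cong (size l +_) (sizes-take-suc ls i))

sizes-take-mono : (ls : List Tree) {m n : ℕ} → m ℕ.≤ n →
  sizes (take m ls) ℕ.≤ sizes (take n ls)
sizes-take-mono ls z≤n = z≤n
sizes-take-mono [] (s≤s m≤n) = z≤n
sizes-take-mono (l ∷ ls) (s≤s m≤n) = ℕP.+-monoʳ-≤ (size l) (sizes-take-mono ls m≤n)

sizes-take-≤ : (ls : List Tree) (n : ℕ) → sizes (take n ls) ℕ.≤ sizes ls
sizes-take-≤ ls ℕ.zero = z≤n
sizes-take-≤ [] (suc n) = z≤n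
sizes-take-≤ (l ∷ ls) (suc n) = ℕP.+-monoʳ-≤ (size l) (sizes-take-≤ ls n)

mutual
  dfs<size : {t : Tree} (p : Pos t) → DFS p ℕ.< size t
  dfs<size {t} root = size-pos t
  dfs<size {node ls h} (light i p) =
    s≤s (ℕP.≤-trans (light-block ls i p)
          (ℕP.≤-trans (sizes-take-≤ ls (suc (toℕ i))) (ℕP.m≤m+n (sizes ls) (size h))))
  dfs<size {node ls h} (heavy p) = s≤s (ℕP.+-monoʳ-< (sizes ls) (dfs<size p))

  light-block : (ls : List Tree) (i : Fin (length ls)) (p : Pos (lookup ls i)) →
    sizes (take (toℕ i) ls) + DFS p ℕ.< sizes (take (suc (toℕ i)) ls)
  light-block ls i p =
    ℕP.<-≤-trans (ℕP.+-monoʳ-< (sizes (take (toℕ i) ls)) (dfs<size p))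
                 (ℕP.≤-reflexive (sizes-take-suc ls i))

⊑-refl : {t : Tree} {x : Pos t} → x ⊑ x
⊑-refl = inj₁ refl

⊏-trans : {t : Tree} {x y z : Pos t} → x ⊏ y → y ⊏ z → x ⊏ z
⊏-trans root⊏light (light⊏light _) = root⊏light
⊏-trans root⊏heavy (heavy⊏heavy _) = root⊏heavy
⊏-trans (light⊏light a) (light⊏light b) = light⊏light (⊏-trans a b)
⊏-trans (heavy⊏heavy a) (heavy⊏heavy b) = heavy⊏heavy (⊏-trans a b)

⊑-⊏-trans : {t : Tree} {x y z : Pos t} → x ⊑ y → y ⊏ z → x ⊏ z
⊑-⊏-trans (inj₁ refl) c = c
⊑-⊏-trans (inj₂ a) c = ⊏-trans a c

⊏-⊑-trans : {t : Tree} {x y z : Pos t} → x ⊏ y → y ⊑ z → x ⊏ z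
⊏-⊑-trans c (inj₁ refl) = c
⊏-⊑-trans c (inj₂ a) = ⊏-trans c a

⊑-trans : {t : Tree} {x y z : Pos t} → x ⊑ y → y ⊑ z → x ⊑ z
⊑-trans (inj₁ refl) b = b
⊑-trans (inj₂ a) b = inj₂ (⊏-⊑-trans a b)

root⊑ : {t : Tree} (p : Pos t) → root ⊑ p
root⊑ root = ⊑-refl
root⊑ (light i p) = inj₂ root⊏light
root⊑ (heavy p) = inj₂ root⊏heavy

light-⊑ : {ls : List Tree} {h : Tree} {i : Fin (length ls)} {x y : Pos (lookup ls i)} →
  x ⊑ y → light {ls} {h} i x ⊑ light i y
light-⊑ (inj₁ refl) = ⊑-refl
light-⊑ (inj₂ c) = inj₂ (light⊏light c)

heavy-⊑ : {ls : List Tree} {h : Tree} {x y : Pos h} → x ⊑ y → heavy {ls} {h} x ⊑ heavy y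
heavy-⊑ (inj₁ refl) = ⊑-refl
heavy-⊑ (inj₂ c) = inj₂ (heavy⊏heavy c)

dfs-⊏ : {t : Tree} {x y : Pos t} → x ⊏ y → DFS x ℕ.< DFS y
dfs-⊏ root⊏light = s≤s z≤n
dfs-⊏ root⊏heavy = s≤s z≤n
dfs-⊏ (light⊏light {ls} {i = i} c) = s≤s (ℕP.+-monoʳ-< (sizes (take (toℕ i) ls)) (dfs-⊏ c))
dfs-⊏ (heavy⊏heavy {ls} c) = s≤s (ℕP.+-monoʳ-< (sizes ls) (dfs-⊏ c))

dfs-≢ : {t : Tree} {x y : Pos t} → DFS x ℕ.< DFS y → x ≢ y
dfs-≢ lt e = ℕP.<-irrefl (cong DFS e) lt

⊏⇒≢ : {t : Tree} {x y : Pos t} → x ⊏ y → x ≢ y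
⊏⇒≢ c = dfs-≢ (dfs-⊏ c)

data Before : {t : Tree} → Pos t → Pos t → Set where
  lightBeforeLight : ∀ {ls h} {i j : Fin (length ls)} {p q} → toℕ i ℕ.< toℕ j →
    Before (light {ls} {h} i p) (light j q)
  lightBeforeHeavy : ∀ {ls h i p q} → Before (light {ls} {h} i p) (heavy q)
  beforeInLight : ∀ {ls h i p q} → Before p q → Before (light {ls} {h} i p) (light i q)
  beforeInHeavy : ∀ {ls h p q} → Before p q → Before (heavy {ls} {h} p) (heavy q)

dfs-Before : {t : Tree} {x y : Pos t} → Before x y → DFS x ℕ.< DFS y
dfs-Before {node ls h} (lightBeforeLight {i = i} {j} {p} {q} lt) =
  s≤s (ℕP.<-≤-trans (light-block ls i p)
        (ℕP.≤-trans (sizes-take-mono ls lt) (ℕP.m≤m+n (sizes (take (toℕ j) ls)) (DFS q))))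
dfs-Before {node ls h} (lightBeforeHeavy {i = i} {p} {q}) =
  s≤s (ℕP.<-≤-trans (light-block ls i p)
        (ℕP.≤-trans (sizes-take-≤ ls (suc (toℕ i))) (ℕP.m≤m+n (sizes ls) (DFS q))))
dfs-Before {node ls h} (beforeInLight {i = i} b) =
  s≤s (ℕP.+-monoʳ-< (sizes (take (toℕ i) ls)) (dfs-Before b))
dfs-Before {node ls h} (beforeInHeavy b) = s≤s (ℕP.+-monoʳ-< (sizes ls) (dfs-Before b))

Before-irrefl : {t : Tree} {x : Pos t} → ¬ Before x x
Before-irrefl b = ℕP.<-irrefl refl (dfs-Before b)

Before-asym : {t : Tree} {x y : Pos t} → Before x y → ¬ Before y x
Before-asym b c = ℕP.<-asym (dfs-Before b) (dfs-Before c)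

Before-descˡ : {t : Tree} {x y x' : Pos t} → Before x y → x ⊏ x' → Before x' y
Before-descˡ (lightBeforeLight lt) (light⊏light _) = lightBeforeLight lt
Before-descˡ lightBeforeHeavy (light⊏light _) = lightBeforeHeavy
Before-descˡ (beforeInLight b) (light⊏light c) = beforeInLight (Before-descˡ b c)
Before-descˡ (beforeInHeavy b) (heavy⊏heavy c) = beforeInHeavy (Before-descˡ b c)

Before-descʳ : {t : Tree} {x y y' : Pos t} → Before x y → y ⊏ y' → Before x y'
Before-descʳ (lightBeforeLight lt) (light⊏light _) = lightBeforeLight lt
Before-descʳ lightBeforeHeavy (heavy⊏heavy _) = lightBeforeHeavy
Before-descʳ (beforeInLight b) (light⊏light c) = beforeInLight (Before-descʳ b c)
Before-descʳ (beforeInHeavy b) (heavy⊏heavy c) = beforeInHeavy (Before-descʳ b c)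

Before-desc : {t : Tree} {x y x' y' : Pos t} → Before x y → x ⊑ x' → y ⊑ y' → Before x' y'
Before-desc b (inj₁ refl) (inj₁ refl) = b
Before-desc b (inj₁ refl) (inj₂ c) = Before-descʳ b c
Before-desc b (inj₂ c) (inj₁ refl) = Before-descˡ b c
Before-desc b (inj₂ c) (inj₂ d) = Before-descʳ (Before-descˡ b c) d

Before-disjoint : {t : Tree} {x y z : Pos t} → Before x y → x ⊑ z → y ⊑ z → ⊥
Before-disjoint b xz yz = Before-irrefl (Before-desc b xz yz)

data Compare {t : Tree} (x y : Pos t) : Set where
  same       : x ≡ y → Compare x y
  ancestor   : x ⊏ y → Compare x y
  descendant : y ⊏ x → Compare x y
  before     : Before x y → Compare x y
  after      : Before y x → Compare x y

compare : {t : Tree} (x y : Pos t) → Compare x y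
compare root root = same refl
compare root (light i q) = ancestor root⊏light
compare root (heavy q) = ancestor root⊏heavy
compare (light i p) root = descendant root⊏light
compare (heavy p) root = descendant root⊏heavy
compare (light i p) (heavy q) = before lightBeforeHeavy
compare (heavy p) (light j q) = after lightBeforeHeavy
compare (heavy p) (heavy q) with compare p q
... | same refl = same refl
... | ancestor c = ancestor (heavy⊏heavy c)
... | descendant c = descendant (heavy⊏heavy c)
... | before b = before (beforeInHeavy b)
... | after b = after (beforeInHeavy b)
compare (light i p) (light j q) with FinP.<-cmp i j
... | tri< lt _ _ = before (lightBeforeLight lt)
... | tri> _ _ gt = after (lightBeforeLight gt)
... | tri≈ _ refl _ with compare p q
...   | same refl = same refl
...   | ancestor c = ancestor (light⊏light c)
...   | descendant c = descendant (light⊏light c)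
...   | before b = before (beforeInLight b)
...   | after b = after (beforeInLight b)

-- The ancestry relation of Defs is
-- defined top-down; arguments by induction along a path from a node to
-- its descendant use the equivalent step-by-step description ⊑*.

-- Child β z w : w is a child of z, and β says whether w is light.
data Child : {t : Tree} → Bool → Pos t → Pos t → Set where
  rootLight    : ∀ {ls h i} → Child true (root {node ls h}) (light {ls} {h} i root)
  rootHeavy    : ∀ {ls h} → Child false (root {node ls h}) (heavy {ls} {h} root)
  childInLight : ∀ {ls h i β p q} → Child β p q → Child β (light {ls} {h} i p) (light i q)
  childInHeavy : ∀ {ls h β p q} → Child β p q → Child β (heavy {ls} {h} p) (heavy q)

child-⊏ : {t : Tree} {β : Bool} {z w : Pos t} → Child β z w → z ⊏ w
child-⊏ rootLight = root⊏light
child-⊏ rootHeavy = root⊏heavy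
child-⊏ (childInLight c) = light⊏light (child-⊏ c)
child-⊏ (childInHeavy c) = heavy⊏heavy (child-⊏ c)

child-nonroot : {t : Tree} {β : Bool} {z w : Pos t} → Child β z w → w ≢ root
child-nonroot rootLight = λ ()
child-nonroot rootHeavy = λ ()
child-nonroot (childInLight c) = λ ()
child-nonroot (childInHeavy c) = λ ()

ifRoot-child : {t : Tree} {β : Bool} {z w : Pos t} → Child β z w →
  {A : Set} {a b : A} → ifRoot w a b ≡ b
ifRoot-child rootLight = refl
ifRoot-child rootHeavy = refl
ifRoot-child (childInLight c) = refl
ifRoot-child (childInHeavy c) = refl

child-parent : {t : Tree} {β : Bool} {z w : Pos t} → Child β z w → parent w ≡ z
child-parent rootLight = refl
child-parent rootHeavy = refl
child-parent (childInLight {i = i} c) = trans (ifRoot-child c) (cong (light i) (child-parent c))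
child-parent (childInHeavy c) = trans (ifRoot-child c) (cong heavy (child-parent c))

child-isLight : {t : Tree} {β : Bool} {z w : Pos t} → Child β z w → isLight w ≡ β
child-isLight rootLight = refl
child-isLight rootHeavy = refl
child-isLight (childInLight c) = child-isLight c
child-isLight (childInHeavy c) = trans (ifRoot-child c) (child-isLight c)

heavyChild-sp : {t : Tree} {z w : Pos t} → Child false z w → sp w ≡ sp z
heavyChild-sp rootHeavy = refl
heavyChild-sp (childInLight {i = i} c) = cong (light i) (heavyChild-sp c)
heavyChild-sp (childInHeavy c) = cong liftH (heavyChild-sp c)

Step : {t : Tree} → Pos t → Pos t → Set
Step z w = Σ Bool λ β → Child β z w

_⊑*_ : {t : Tree} → Pos t → Pos t → Set
_⊑*_ = Star Step

step-⊏ : {t : Tree} {z w : Pos t} → Step z w → z ⊏ w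
step-⊏ (_ , c) = child-⊏ c

light-⊑* : {ls : List Tree} {h : Tree} {i : Fin (length ls)} {x y : Pos (lookup ls i)} →
  x ⊑* y → light {ls} {h} i x ⊑* light i y
light-⊑* {i = i} = gmap (light i) λ { (β , c) → β , childInLight c }

heavy-⊑* : {ls : List Tree} {h : Tree} {x y : Pos h} → x ⊑* y → heavy {ls} {h} x ⊑* heavy y
heavy-⊑* = gmap heavy λ { (β , c) → β , childInHeavy c }

root⊑* : {t : Tree} (p : Pos t) → root ⊑* p
root⊑* root = ε
root⊑* (light i p) = (true , rootLight) ◅ light-⊑* (root⊑* p)
root⊑* (heavy p) = (false , rootHeavy) ◅ heavy-⊑* (root⊑* p)

first-step : {t : Tree} {x y : Pos t} → x ⊏ y → ∃ λ c → Step x c × c ⊑* y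
first-step (root⊏light {p = p}) = _ , (true , rootLight) , light-⊑* (root⊑* p)
first-step (root⊏heavy {p = p}) = _ , (false , rootHeavy) , heavy-⊑* (root⊑* p)
first-step (light⊏light c) with first-step c
... | _ , (β , d) , p = _ , (β , childInLight d) , light-⊑* p
first-step (heavy⊏heavy c) with first-step c
... | _ , (β , d) , p = _ , (β , childInHeavy d) , heavy-⊑* p

⊑⇒⊑* : {t : Tree} {x y : Pos t} → x ⊑ y → x ⊑* y
⊑⇒⊑* (inj₁ refl) = ε
⊑⇒⊑* (inj₂ c) with first-step c
... | _ , s , p = s ◅ p

⊑*⇒⊑ : {t : Tree} {x y : Pos t} → x ⊑* y → x ⊑ y
⊑*⇒⊑ = fold _⊑_ (λ s q → inj₂ (⊏-⊑-trans (step-⊏ s) q)) ⊑-refl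

data Branching {t : Tree} (x y : Pos t) : Set where
  branching : ∀ {a c₁ c₂ β} → Child true a c₁ → Child β a c₂ →
    c₁ ⊑ x → c₂ ⊑ y → Before c₁ c₂ → Branching x y

branch : {t : Tree} {x y : Pos t} → Before x y → Branching x y
branch (lightBeforeLight {p = p} {q} lt) =
  branching rootLight rootLight (light-⊑ (root⊑ p)) (light-⊑ (root⊑ q)) (lightBeforeLight lt)
branch (lightBeforeHeavy {p = p} {q}) =
  branching rootLight rootHeavy (light-⊑ (root⊑ p)) (heavy-⊑ (root⊑ q)) lightBeforeHeavy
branch (beforeInLight b) with branch b
... | branching d c e₁ e₂ bc =
  branching (childInLight d) (childInLight c) (light-⊑ e₁) (light-⊑ e₂) (beforeInLight bc)
branch (beforeInHeavy b) with branch b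
... | branching d c e₁ e₂ bc =
  branching (childInHeavy d) (childInHeavy c) (heavy-⊑ e₁) (heavy-⊑ e₂) (beforeInHeavy bc)

-- Supervisors and heavy paths: sp u is the top of the maximal heavy path
-- through u, and a heavy path is the DFS-last branch below its top.

_⊑H_ : {t : Tree} → Pos t → Pos t → Set
_⊑H_ = Star (Child false)

⊑H⇒⊑ : {t : Tree} {x y : Pos t} → x ⊑H y → x ⊑ y
⊑H⇒⊑ p = ⊑*⇒⊑ (Star-map (false ,_) p)

⊑H-sp : {t : Tree} {x y : Pos t} → x ⊑H y → sp y ≡ sp x
⊑H-sp ε = refl
⊑H-sp (c ◅ p) = trans (⊑H-sp p) (heavyChild-sp c)

sp⊑H : {t : Tree} (u : Pos t) → sp u ⊑H u
sp⊑H root = ε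
sp⊑H (light i p) = gmap (light i) childInLight (sp⊑H p)
sp⊑H (heavy p) with sp p | sp⊑H p
... | root | q = rootHeavy ◅ gmap heavy childInHeavy q
... | light i s | q = gmap heavy childInHeavy q
... | heavy s | q = gmap heavy childInHeavy q

sp⊑ : {t : Tree} (u : Pos t) → sp u ⊑ u
sp⊑ u = ⊑H⇒⊑ (sp⊑H u)

isLight-sp : {t : Tree} (u : Pos t) → isLight (sp u) ≡ true
isLight-sp root = refl
isLight-sp (light i p) = isLight-sp p
isLight-sp (heavy p) with sp p | isLight-sp p
... | root | e = refl
... | light i s | e = e
... | heavy s | e = e

light-sp : {t : Tree} (s : Pos t) → isLight s ≡ true → sp s ≡ s
light-sp root e = refl
light-sp (light i p) e = cong (light i) (light-sp p e)
light-sp (heavy root) ()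
light-sp (heavy p@(light _ _)) e = cong liftH (light-sp p e)
light-sp (heavy p@(heavy _)) e = cong liftH (light-sp p e)

heavy≢sp : {t : Tree} {u : Pos t} → isLight u ≡ false → u ≢ sp u
heavy≢sp {u = u} h e with trans (sym h) (trans (cong isLight e) (isLight-sp u))
... | ()

heavyChild-last : {t : Tree} {z c v : Pos t} → Child false z c → z ⊏ v → c ⊑ v ⊎ Before v c
heavyChild-last rootHeavy root⊏light = inj₂ lightBeforeHeavy
heavyChild-last rootHeavy (root⊏heavy {p = p}) = inj₁ (heavy-⊑ (root⊑ p))
heavyChild-last (childInLight c) (light⊏light d) with heavyChild-last c d
... | inj₁ e = inj₁ (light-⊑ e)
... | inj₂ b = inj₂ (beforeInLight b)
heavyChild-last (childInHeavy c) (heavy⊏heavy d) with heavyChild-last c d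
... | inj₁ e = inj₁ (heavy-⊑ e)
... | inj₂ b = inj₂ (beforeInHeavy b)

heavyPath-heavy : {t : Tree} {a u v : Pos t} → a ⊑H u → a ⊏ v → v ⊑ u → isLight v ≡ false
heavyPath-heavy ε av vu = ⊥-elim (⊏⇒≢ (⊏-⊑-trans av vu) refl)
heavyPath-heavy (c ◅ p) av vu with heavyChild-last c av
... | inj₁ (inj₁ refl) = child-isLight c
... | inj₁ (inj₂ cv) = heavyPath-heavy p cv vu
... | inj₂ vc = ⊥-elim (Before-disjoint vc vu (⊑H⇒⊑ p))

heavyPath-last : {t : Tree} {a u v : Pos t} → a ⊑H u → a ⊏ v → ¬ Before u v
heavyPath-last ε av b = Before-disjoint b (inj₂ av) ⊑-refl
heavyPath-last (c ◅ p) av b with heavyChild-last c av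
... | inj₁ (inj₁ refl) = Before-disjoint b ⊑-refl (⊑H⇒⊑ p)
... | inj₁ (inj₂ cv) = heavyPath-last p cv b
... | inj₂ vc = Before-asym b (Before-desc vc ⊑-refl (⊑H⇒⊑ p))

data Exit {t : Tree} (b y : Pos t) : Set where
  heavyEnd  : ∀ {z} → b ⊑H z → Child false z y → Exit b y
  lightExit : ∀ {z w} → b ⊑H z → Child true z w → w ⊑ y → Exit b y

exit : {t : Tree} {b y : Pos t} → b ⊏ y → Exit b y
exit by with first-step by
... | _ , s , p = go s p
  where
  go : ∀ {t} {b c y : Pos t} → Step b c → c ⊑* y → Exit b y
  go (true , d) p = lightExit ε d (⊑*⇒⊑ p)
  go (false , d) ε = heavyEnd ε d
  go (false , d) (s ◅ p) with go s p
  ... | heavyEnd h e = heavyEnd (d ◅ h) e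
  ... | lightExit h e q = lightExit (d ◅ h) e q

⊆-refl : (J : Interval) → J ⊆ᵢ J
⊆-refl J z m = m

⊆-trans : (A B C : Interval) → A ⊆ᵢ B → B ⊆ᵢ C → A ⊆ᵢ C
⊆-trans A B C f g z m = g z (f z m)

≐-refl : (J : Interval) → J ≐ J
≐-refl J = ⊆-refl J , ⊆-refl J

⊂-irrefl : (J : Interval) → ¬ (J ⊂ᵢ J)
⊂-irrefl J (_ , n) = n (≐-refl J)

lo-mono : (J K : Interval) → J ⊆ᵢ K → lo K ℤ.≤ lo J
lo-mono J K s = proj₁ (s (lo J) (ℤP.≤-refl , lo≤hi J))

hi-mono : (J K : Interval) → J ⊆ᵢ K → hi J ℤ.≤ hi K
hi-mono J K s = proj₂ (s (hi J) (lo≤hi J , ℤP.≤-refl))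

≺-⊆ : (A B C : Interval) → A ≺ B → C ⊆ᵢ B → A ≺ C
≺-⊆ A B C p s = ℤP.<-≤-trans p (lo-mono C B s)

⊆-≺ : (A B C : Interval) → C ⊆ᵢ A → A ≺ B → C ≺ B
⊆-≺ A B C s p = ℤP.≤-<-trans (hi-mono C A s) p

≺-asym : (A B : Interval) → A ≺ B → ¬ (B ≺ A)
≺-asym A B p q = ℤP.<-asym (ℤP.<-≤-trans p (lo≤hi B)) (ℤP.<-≤-trans q (lo≤hi A))

≺⇒⊈ : (A B : Interval) → A ≺ B → ¬ (A ⊆ᵢ B)
≺⇒⊈ A B p s = ℤP.<-irrefl refl (ℤP.<-≤-trans (ℤP.≤-<-trans (lo≤hi A) p) (lo-mono A B s))

≻⇒⊈ : (A B : Interval) → B ≺ A → ¬ (A ⊆ᵢ B)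
≻⇒⊈ A B p s = ℤP.<-irrefl refl (ℤP.≤-<-trans (ℤP.≤-trans (lo≤hi A) (hi-mono A B s)) p)

module Characterisation (T : Tree) (I : Pos T → Interval)
  (distinct : ∀ (u v : Pos T) → u ≢ v → ¬ (I u ≐ I v))
  (lpo1 : ∀ (u : Pos T) → u ≢ root → I u ⊆ᵢ I (sp u) ∩ I (sp (parent u)))
  (lpo2 : ∀ (u x : Pos T) → InLqa u x → I x ≺ I u) where

  inside-sp : (w : Pos T) → I w ⊆ᵢ I (sp w)
  inside-sp root = ⊆-refl (I root)
  inside-sp w@(light _ _) z m = proj₁ (lpo1 w (λ ()) z m)
  inside-sp w@(heavy _) z m = proj₁ (lpo1 w (λ ()) z m)

  -- One step down does not enlarge the interval of the supervisor: a light
  -- child is its own supervisor and lies inside sp of its parent (LPO1),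
  -- a heavy child shares the supervisor of its parent.
  step-sp : {z w : Pos T} → Step z w → I (sp w) ⊆ᵢ I (sp z)
  step-sp {w = w} (true , c) =
    subst₂ (λ a b → I a ⊆ᵢ I (sp b)) (sym (light-sp w (child-isLight c))) (child-parent c)
      (λ z m → proj₂ (lpo1 w (child-nonroot c) z m))
  step-sp {z} (false , c) =
    subst (λ s → I s ⊆ᵢ I (sp z)) (sym (heavyChild-sp c)) (⊆-refl (I (sp z)))

  sp-antitone : {x y : Pos T} → x ⊑* y → I (sp y) ⊆ᵢ I (sp x)
  sp-antitone {x} ε = ⊆-refl (I (sp x))
  sp-antitone {x} {y} (_◅_ {j = c} s p) =
    ⊆-trans (I (sp y)) (I (sp c)) (I (sp x)) (sp-antitone p) (step-sp s)

  nested : {s w : Pos T} → isLight s ≡ true → s ⊑ w → I w ⊆ᵢ I s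
  nested {s} {w} e sw =
    ⊆-trans (I w) (I (sp w)) (I s) (inside-sp w)
      (subst (λ x → I (sp w) ⊆ᵢ I x) (light-sp s e) (sp-antitone (⊑⇒⊑* sw)))

  sp-parent : {a z w : Pos T} {β : Bool} → a ⊑H z → Child β z w → sp (parent w) ≡ sp a
  sp-parent h c = trans (cong sp (child-parent c)) (⊑H-sp h)

  on-Pu : {a z w y : Pos T} {β : Bool} → a ⊑H z → Child β z w → sp a ⊑ y → y ⊑ a → OnPu w y
  on-Pu h c s ya =
    subst (_⊑ _) (sym (sp-parent h c)) s ,
    subst (_ ⊑_) (sym (child-parent c)) (⊑-trans ya (⊑H⇒⊑ h))

  heavy-before-child : {u z w : Pos T} {β : Bool} → isLight u ≡ false →
    u ⊑H z → Child β z w → I u ≺ I w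
  heavy-before-child {u} {w = w} lf h c =
    lpo2 _ u (child-nonroot c , inj₁ (on-Pu h c (sp⊑ u) ⊑-refl) ,
              ⊏⇒≢ uw , u≢sp , ℕP.<⇒≤ (dfs-⊏ uw))
    where
    uw : u ⊏ w
    uw = ⊑-⊏-trans (⊑H⇒⊑ h) (child-⊏ c)
    u≢sp : u ≢ sp (parent w)
    u≢sp e = heavy≢sp lf (trans e (sp-parent h c))

  lightChild-before-child : {a x z w : Pos T} {β : Bool} → Child true a x →
    a ⊑H z → Child β z w → Before x w → I x ≺ I w
  lightChild-before-child {a} {x} {w = w} d h c b =
    lpo2 w x (child-nonroot c ,
              inj₂ (child-nonroot d , child-isLight d ,
                    subst (OnPu w) (sym (child-parent d)) (on-Pu h c (sp⊑ a) ⊑-refl)) ,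
              dfs-≢ (dfs-Before b) , x≢sp , ℕP.<⇒≤ (dfs-Before b))
    where
    x≢sp : x ≢ sp (parent w)
    x≢sp e = ⊏⇒≢ (⊑-⊏-trans (sp⊑ a) (child-⊏ d)) (sym (trans e (sp-parent h c)))

  before-below : {x b y : Pos T} → b ⊏ y →
    (∀ {z w β} → b ⊑H z → Child β z w → I x ≺ I w) → I x ≺ I y
  before-below {x} {y = y} by hyp with exit by
  ... | heavyEnd h c = hyp h c
  ... | lightExit {w = w} h c wy = ≺-⊆ (I x) (I w) (I y) (hyp h c) (nested (child-isLight c) wy)

  heavy-before-desc : {u v : Pos T} → isLight u ≡ false → u ⊏ v → I u ≺ I v
  heavy-before-desc lf uv = before-below uv (heavy-before-child lf)

  lightChild-before : {a x c y : Pos T} {β : Bool} → Child true a x → Child β a c →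
    Before x c → c ⊑ y → I x ≺ I y
  lightChild-before {x = x} {c} {y} {β = true} ax ac b cy =
    ≺-⊆ (I x) (I c) (I y) (lightChild-before-child ax ε ac b) (nested (child-isLight ac) cy)
  lightChild-before {β = false} ax ac b (inj₁ refl) = lightChild-before-child ax ε ac b
  lightChild-before {β = false} ax ac b (inj₂ cy) =
    before-below cy λ h e →
      lightChild-before-child ax (ac ◅ h) e
        (Before-desc b ⊑-refl (inj₂ (⊑-⊏-trans (⊑H⇒⊑ h) (child-⊏ e))))

  before-≺ : {x y : Pos T} → Before x y → I x ≺ I y
  before-≺ {x} {y} b with branch b
  ... | branching {c₁ = c₁} d c e₁ e₂ bc =
    ⊆-≺ (I c₁) (I y) (I x) (nested (child-isLight d) e₁) (lightChild-before d c bc e₂)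

  sp-fixed : {u : Pos T} → I u ≐ I (sp u) → sp u ≡ u
  sp-fixed {u} e with isLight u in eq
  ... | true = light-sp u eq
  ... | false = ⊥-elim (distinct u (sp u) (heavy≢sp eq) e)

  D1 D2 : Pos T → Pos T → Set
  D1 u v = I v ⊂ᵢ I (sp u)
  D2 u v = I u ≺ I v ⊎ I u ≐ I (sp u)

  ancestor⇒D1 : {u v : Pos T} → u ⊏ v → D1 u v
  ancestor⇒D1 {u} {v} uv =
    nested (isLight-sp u) (inj₂ sv) , distinct v (sp u) (λ e → ⊏⇒≢ sv (sym e))
    where
    sv : sp u ⊏ v
    sv = ⊑-⊏-trans (sp⊑ u) uv

  ancestor⇒D2 : {u v : Pos T} → u ⊏ v → D2 u v
  ancestor⇒D2 {u} uv with isLight u in eq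
  ... | true = inj₂ (subst (λ s → I u ≐ I s) (sym (light-sp u eq)) (≐-refl (I u)))
  ... | false = inj₁ (heavy-before-desc eq uv)

  not-descendant : {u v : Pos T} → v ⊏ u → D1 u v → D2 u v → ⊥
  not-descendant {u} {v} vu d1 d2 with compare v (sp u)
  ... | same refl = ⊂-irrefl (I v) d1
  ... | ancestor vs = above-sp (isLight v) refl
    where
    -- a light v would contain I(sp u); a heavy v would precede it
    above-sp : (β : Bool) → isLight v ≡ β → ⊥
    above-sp true e = proj₂ d1 (proj₁ d1 , nested e (inj₂ vs))
    above-sp false e = ≺⇒⊈ (I v) (I (sp u)) (heavy-before-desc e vs) (proj₁ d1)
  ... | descendant sv = on-heavy-path d2
    where
    -- v is a heavy node strictly between sp u and u
    on-heavy-path : D2 u v → ⊥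
    on-heavy-path (inj₁ uv) =
      ≺-asym (I u) (I v) uv (heavy-before-desc (heavyPath-heavy (sp⊑H u) sv (inj₂ vu)) vu)
    on-heavy-path (inj₂ e) = distinct u (sp u) (λ us → ⊏⇒≢ (⊏-trans sv vu) (sym us)) e
  ... | before b = Before-disjoint b (inj₂ vu) (sp⊑ u)
  ... | after b = Before-disjoint b (sp⊑ u) (inj₂ vu)

  not-before : {u v : Pos T} → Before u v → D1 u v → ⊥
  not-before {u} {v} b d1 with compare (sp u) v
  ... | same refl = ⊂-irrefl (I v) d1
  ... | ancestor sv = heavyPath-last (sp⊑H u) sv b
  ... | descendant vs = Before-disjoint b ⊑-refl (inj₂ (⊏-⊑-trans vs (sp⊑ u)))
  ... | before b' = ≻⇒⊈ (I v) (I (sp u)) (before-≺ b') (proj₁ d1)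
  ... | after b' = ≺⇒⊈ (I v) (I (sp u)) (before-≺ b') (proj₁ d1)

  not-after : {u v : Pos T} → Before v u → D1 u v → D2 u v → ⊥
  not-after {u} {v} b d1 (inj₁ uv) = ≺-asym (I u) (I v) uv (before-≺ b)
  not-after {u} {v} b d1 (inj₂ e) =
    ≺⇒⊈ (I v) (I u) (before-≺ b) (subst (λ s → I v ⊆ᵢ I s) (sp-fixed e) (proj₁ d1))

  D⇒ancestor : {u v : Pos T} → u ≢ v → D1 u v → D2 u v → u ⊏ v
  D⇒ancestor {u} {v} u≢v d1 d2 with compare u v
  ... | same e = ⊥-elim (u≢v e)
  ... | ancestor uv = uv
  ... | descendant vu = ⊥-elim (not-descendant vu d1 d2)
  ... | before b = ⊥-elim (not-before b d1)
  ... | after b = ⊥-elim (not-after b d1 d2)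

claim2 : (T : Tree) → WF T → (I : Pos T → Interval) →
    (∀ (u v : Pos T) → u ≢ v → ¬ (I u ≐ I v)) →
    (∀ (u : Pos T) → u ≢ root → I u ⊆ᵢ I (sp u) ∩ I (sp (parent u))) →
    (∀ (u x : Pos T) → InLqa u x → I x ≺ I u) →
    ∀ (u v : Pos T) → u ≢ v →
      (u ⊏ v ⇔ (I v ⊂ᵢ I (sp u) × (I u ≺ I v ⊎ I u ≐ I (sp u))))
claim2 T _ I distinct lpo1 lpo2 u v u≢v =
  mk⇔ (λ uv → ancestor⇒D1 uv , ancestor⇒D2 uv)
      (λ (d1 , d2) → D⇒ancestor u≢v d1 d2)
  where open Characterisation T I distinct lpo1 lpo2
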